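{- Let $G$ be an ordered graph and let $A,B\subseteq V(G)$ be disjoint cliques. Then $G[A\cup B]$ is induced $D$-free if and only if there is a partition $V(G)=I\cup J$ into intervals with $I<J$ such that: (1) there are no edges between $A\cap I$ and $B\cap I$; (2) every vertex of $A\cap J$ is adjacent to every vertex of $B\cap J$, i.e. $(A\cup B)\cap J$ is a clique; (3) for every $b\in B\cap J$, $N_{A\cap I}(b)$ is a suffix of $A\cap I$; (4) for every $a\in A\cap J$, $N_{B\cap I}(a)$ is a suffix of $B\cap I$.
   Context: An ordered graph is a graph with a linear order on its vertex set. $D$ is the ordered graph with vertices $x<y<z$ and edges $\{x,y\},\{x,z\}$; an induced copy of $D$ is a triple $u<v<w$ with $\{u,v\},\{u,w\}$ edges and $\{v,w\}$ a non-edge, and induced $D$-free means containing no such triple. An interval of $V(G)$ is a set of the form $\{x: a\leq x\leq b\}$; in the partition $V(G)=I\cup J$ one of the two intervals may be empty. $I<J$ means every element of $I$ precedes every element of $J$. $N_X(v)$ is the set of neighbours of $v$ in $X$. A subset $X'\subseteq X$ is a suffix of $X$ if whenever $x_1\in X'$, $x_2\in X$ and $x_1<x_2$, then $x_2\in X'$. -}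

module Defs where

open import Data.Nat using (ℕ; _≤_) renaming (_<_ to _<ℕ_)
open import Data.Bool using (Bool; true; false)
open import Data.Empty using (⊥)
open import Data.Fin using (Fin; toℕ; _<_)
open import Data.Fin.Subset using (Subset; _∈_)
open import Data.Product using (_×_; ∃-syntax)
open import Relation.Nullary using (¬_)
open import Relation.Binary.PropositionalEquality using (_≡_; _≢_)

-- A (finite) ordered graph: vertex set Fin n with its natural linear order,
-- adjacency a symmetric irreflexive Bool-valued relation.
record OrderedGraph (n : ℕ) : Set where
  field
    edge   : Fin n → Fin n → Bool
    sym    : ∀ u v → edge u v ≡ edge v u
    irrefl : ∀ v → edge v v ≡ false
open OrderedGraph public

Adj : ∀ {n} → OrderedGraph n → Fin n → Fin n → Set
Adj G u v = edge G u v ≡ true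

IsClique : ∀ {n} → OrderedGraph n → Subset n → Set
IsClique G X = ∀ u v → u ∈ X → v ∈ X → u ≢ v → Adj G u v

Disjoint : ∀ {n} → Subset n → Subset n → Set
Disjoint X Y = ∀ v → v ∈ X → v ∈ Y → ⊥

_∈_∪_ : ∀ {n} → Fin n → Subset n → Subset n → Set
v ∈ X ∪ Y = (v ∈ X) ⊎ (v ∈ Y)
  where open import Data.Sum using (_⊎_)

InducedD : ∀ {n} → OrderedGraph n → (Fin n → Set) → Fin n → Fin n → Fin n → Set
InducedD G X u v w =
  X u × X v × X w × u < v × v < w × Adj G u v × Adj G u w × ¬ Adj G v w

InducedDFree : ∀ {n} → OrderedGraph n → (Fin n → Set) → Set
InducedDFree G X = ¬ (∃[ u ] ∃[ v ] ∃[ w ] InducedD G X u v w)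

-- The partition V(G) = I ∪ J into intervals with I < J is given by a cut
-- k ≤ n:  I = {v | toℕ v < k},  J = {v | k ≤ toℕ v}  (either may be empty).
InI : ∀ {n} → ℕ → Fin n → Set
InI k v = toℕ v <ℕ k

InJ : ∀ {n} → ℕ → Fin n → Set
InJ k v = k ≤ toℕ v

NbhdSuffix : ∀ {n} → OrderedGraph n → (Fin n → Set) → Fin n → Set
NbhdSuffix G X b = ∀ x₁ x₂ → X x₁ → X x₂ → x₁ < x₂ → Adj G b x₁ → Adj G b x₂

Conditions : ∀ {n} → OrderedGraph n → Subset n → Subset n → ℕ → Set
Conditions G A B k =
  (∀ a b → a ∈ A → InI k a → b ∈ B → InI k b → ¬ Adj G a b)
  × (∀ a b → a ∈ A → InJ k a → b ∈ B → InJ k b → Adj G a b)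
  × (∀ b → b ∈ B → InJ k b → NbhdSuffix G (λ x → x ∈ A × InI k x) b)
  × (∀ a → a ∈ A → InJ k a → NbhdSuffix G (λ x → x ∈ B × InI k x) a)

-- Forwards: cut at the least vertex c having an earlier neighbour x on the other side.
-- Below the cut no edge joins A and B, since its later end would precede c.  Above it,
-- D-freeness applied to the root x makes c adjacent to every later vertex of x's
-- clique, and then, applied to the root c, makes every later vertex of c's clique
-- adjacent to those too.  The suffix conditions are D-freeness with the root in the
-- neighbourhood.  Backwards: in an induced D the two later vertices lie in different
-- cliques, and the four conditions rule out each placement of the three vertices
-- relative to the cut.
module Submission where

open import Defs
open import Data.Nat using (ℕ; _≤_)
import Data.Nat.Properties as ℕ
open import Data.Fin using (Fin; toℕ; _<_; fromℕ<; inject)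
open import Data.Fin.Properties
  using (toℕ-injective; toℕ-inject; toℕ-fromℕ<; toℕ<n; <-cmp; <⇒≢; _≟_; _<?_; any?; ≤∧≢⇒<; all?; ¬∀⟶∃¬-smallest)
open import Data.Fin.Subset using (Subset; _∈_)
open import Data.Fin.Subset.Properties using (_∈?_)
open import Data.Bool using (true)
import Data.Bool.Properties as Bool
open import Data.Empty using (⊥-elim)
open import Data.Product using (_×_; ∃-syntax; _,_)
open import Data.Sum as Sum using (_⊎_; inj₁; inj₂)
open import Function.Base using (_∘_)
open import Function.Bundles using (_⇔_; mk⇔)
open import Relation.Nullary using (¬_; Dec; yes; no)
open import Relation.Nullary.Decidable using (¬?; decidable-stable; _×-dec_; _⊎-dec_)
open import Relation.Binary.Definitions using (tri<; tri≈; tri>)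
open import Relation.Binary.PropositionalEquality using (_≡_; _≢_; refl; trans; subst) renaming (sym to ≡-sym)

least-or-none : ∀ {n} {P : Fin n → Set} → (∀ c → Dec (P c)) →
                (∀ c → ¬ P c) ⊎ ∃[ c ] (P c × (∀ c′ → c′ < c → ¬ P c′))
least-or-none {n} {P} P? with all? (λ c → ¬? (P? c))
... | yes none = inj₁ none
... | no some with ¬∀⟶∃¬-smallest n (λ c → ¬ P c) (λ c → ¬? (P? c)) some
...   | c , ¬¬Pc , below = inj₂ (c , decidable-stable (P? c) ¬¬Pc , below′)
  where
  below′ : ∀ c′ → c′ < c → ¬ P c′
  below′ c′ c′<c = subst (λ d → ¬ P d) inject-fromℕ< (below (fromℕ< c′<c))
    where
    inject-fromℕ< : inject (fromℕ< c′<c) ≡ c′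
    inject-fromℕ< = toℕ-injective (trans (toℕ-inject (fromℕ< c′<c)) (toℕ-fromℕ< c′<c))

Disjoint⇒≢ : ∀ {n} {X Y : Subset n} {x y} → Disjoint X Y → x ∈ X → y ∈ Y → x ≢ y
Disjoint⇒≢ disj x∈X y∈Y refl = disj _ x∈X y∈Y

Disjoint-sym : ∀ {n} {X Y : Subset n} → Disjoint X Y → Disjoint Y X
Disjoint-sym disj v v∈Y v∈X = disj v v∈X v∈Y

Cross : ∀ {n} → Subset n → Subset n → Fin n → Fin n → Set
Cross X Y u v = (u ∈ X × v ∈ Y) ⊎ (u ∈ Y × v ∈ X)

module _ {n : ℕ} (G : OrderedGraph n) where

  Adj-sym : ∀ {u v} → Adj G u v → Adj G v u
  Adj-sym {u} {v} uv = trans (sym G v u) uv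

  Adj? : ∀ u v → Dec (Adj G u v)
  Adj? u v = edge G u v Bool.≟ true

  BackCross : Subset n → Subset n → Fin n → Set
  BackCross X Y c = ∃[ x ] (x < c × Cross X Y c x × Adj G c x)

  BackCross? : ∀ X Y c → Dec (BackCross X Y c)
  BackCross? X Y c = any? λ x →
    (x <? c) ×-dec (((c ∈? X) ×-dec (x ∈? Y)) ⊎-dec ((c ∈? Y) ×-dec (x ∈? X))) ×-dec Adj? c x

  no-BackCross⇒no-cross-edge :
    ∀ {X Y k} → Disjoint X Y → (∀ c → InI k c → ¬ BackCross X Y c) →
    ∀ x y → x ∈ X → InI k x → y ∈ Y → InI k y → ¬ Adj G x y
  no-BackCross⇒no-cross-edge disj none x y x∈X x∈I y∈Y y∈I xy with <-cmp x y
  ... | tri< x<y _ _ = none y y∈I (x , x<y , inj₂ (y∈Y , x∈X) , Adj-sym xy)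
  ... | tri≈ _ x≡y _ = Disjoint⇒≢ disj x∈X y∈Y x≡y
  ... | tri> _ _ y<x = none x x∈I (y , y<x , inj₁ (x∈X , y∈Y) , xy)

  Conditions-swap : ∀ {X Y k} → Conditions G X Y k → Conditions G Y X k
  Conditions-swap (c₁ , c₂ , c₃ , c₄) =
      (λ y x y∈Y y∈I x∈X x∈I yx → c₁ x y x∈X x∈I y∈Y y∈I (Adj-sym yx))
    , (λ y x y∈Y y∈J x∈X x∈J → Adj-sym (c₂ x y x∈X x∈J y∈Y y∈J))
    , c₄
    , c₃

  Conditions-common-left-neighbour :
    ∀ {X Y k u v w} → Conditions G X Y k → u ∈ X ∪ Y → v ∈ X → w ∈ Y →
    u < v → v < w → Adj G u v → Adj G u w → Adj G v w
  Conditions-common-left-neighbour {k = k} {u} {v} {w} (c₁ , c₂ , c₃ , c₄) u∈X∪Y v∈X w∈Y u<v v<w uv uw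
    with toℕ v ℕ.<? k
  ... | no v∉I = c₂ v w v∈X v∈J w∈Y (ℕ.≤-trans v∈J (ℕ.<⇒≤ v<w))
    where
    v∈J : InJ k v
    v∈J = ℕ.≮⇒≥ v∉I
  ... | yes v∈I with u∈X∪Y | toℕ w ℕ.<? k
  ...   | inj₂ u∈Y | _         = ⊥-elim (c₁ v u v∈X v∈I u∈Y (ℕ.<-trans u<v v∈I) (Adj-sym uv))
  ...   | inj₁ u∈X | yes w∈I   = ⊥-elim (c₁ u w u∈X (ℕ.<-trans u<v v∈I) w∈Y w∈I uw)
  ...   | inj₁ u∈X | no w∉I    =
    Adj-sym (c₃ w w∈Y (ℕ.≮⇒≥ w∉I) u v (u∈X , ℕ.<-trans u<v v∈I) (v∈X , v∈I) u<v (Adj-sym uw))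

  Conditions⇒DFree : ∀ {A B k} → IsClique G A → IsClique G B →
                     Conditions G A B k → InducedDFree G (λ v → v ∈ A ∪ B)
  Conditions⇒DFree cA cB conds (u , v , w , u∈S , v∈S , w∈S , u<v , v<w , uv , uw , ¬vw)
    with v∈S | w∈S
  ... | inj₁ v∈A | inj₁ w∈A = ¬vw (cA v w v∈A w∈A (<⇒≢ v<w))
  ... | inj₂ v∈B | inj₂ w∈B = ¬vw (cB v w v∈B w∈B (<⇒≢ v<w))
  ... | inj₁ v∈A | inj₂ w∈B = ¬vw (Conditions-common-left-neighbour conds u∈S v∈A w∈B u<v v<w uv uw)
  ... | inj₂ v∈B | inj₁ w∈A =
    ¬vw (Conditions-common-left-neighbour (Conditions-swap conds) (Sum.swap u∈S) v∈B w∈A u<v v<w uv uw)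

  module _ {S : Fin n → Set} (free : InducedDFree G S) where

    DFree⇒Adj : ∀ {u v w} → S u → S v → S w → u < v → v < w →
                Adj G u v → Adj G u w → Adj G v w
    DFree⇒Adj {u} {v} {w} u∈S v∈S w∈S u<v v<w uv uw with Adj? v w
    ... | yes vw = vw
    ... | no ¬vw = ⊥-elim (free (u , v , w , u∈S , v∈S , w∈S , u<v , v<w , uv , uw , ¬vw))

    DFree-common-left-neighbour : ∀ {u v w} → S u → S v → S w → u < v → u < w → v ≢ w →
                                  Adj G u v → Adj G u w → Adj G v w
    DFree-common-left-neighbour {u} {v} {w} u∈S v∈S w∈S u<v u<w v≢w uv uw with <-cmp v w
    ... | tri< v<w _ _ = DFree⇒Adj u∈S v∈S w∈S u<v v<w uv uw
    ... | tri≈ _ v≡w _ = ⊥-elim (v≢w v≡w)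
    ... | tri> _ _ w<v = Adj-sym (DFree⇒Adj u∈S w∈S v∈S u<w w<v uw uv)

    clique-nbhd-suffix : ∀ {X k b} → IsClique G X → (∀ v → v ∈ X → S v) → S b → InJ k b →
                         NbhdSuffix G (λ x → x ∈ X × InI k x) b
    clique-nbhd-suffix cX X⊆S b∈S b∈J x₁ x₂ (x₁∈X , _) (x₂∈X , x₂∈I) x₁<x₂ bx₁ =
      Adj-sym (DFree⇒Adj (X⊆S x₁ x₁∈X) (X⊆S x₂ x₂∈X) b∈S x₁<x₂ (ℕ.<-≤-trans x₂∈I b∈J)
                         (cX x₁ x₂ x₁∈X x₂∈X (<⇒≢ x₁<x₂)) (Adj-sym bx₁))

    back-cross-edge⇒adj-beyond :
      ∀ {X Y c x} → Disjoint X Y → IsClique G Y → (∀ v → v ∈ X → S v) → (∀ v → v ∈ Y → S v) →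
      c ∈ X → x ∈ Y → x < c → Adj G c x → ∀ b → b ∈ Y → InJ (toℕ c) b → Adj G c b
    back-cross-edge⇒adj-beyond {c = c} {x} disj cY X⊆S Y⊆S c∈X x∈Y x<c cx b b∈Y c≤b =
      DFree-common-left-neighbour (Y⊆S x x∈Y) (X⊆S c c∈X) (Y⊆S b b∈Y) x<c x<b
        (Disjoint⇒≢ disj c∈X b∈Y) (Adj-sym cx) (cY x b x∈Y b∈Y (<⇒≢ x<b))
      where
      x<b : x < b
      x<b = ℕ.<-≤-trans x<c c≤b

    complete-beyond-back-cross-edge :
      ∀ {X Y c x} → Disjoint X Y → IsClique G X → IsClique G Y →
      (∀ v → v ∈ X → S v) → (∀ v → v ∈ Y → S v) →
      c ∈ X → x ∈ Y → x < c → Adj G c x →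
      ∀ a b → a ∈ X → InJ (toℕ c) a → b ∈ Y → InJ (toℕ c) b → Adj G a b
    complete-beyond-back-cross-edge {c = c} disj cX cY X⊆S Y⊆S c∈X x∈Y x<c cx a b a∈X c≤a b∈Y c≤b
      with a ≟ c
    ... | yes refl = back-cross-edge⇒adj-beyond disj cY X⊆S Y⊆S c∈X x∈Y x<c cx b b∈Y c≤b
    ... | no a≢c =
      DFree-common-left-neighbour (X⊆S c c∈X) (X⊆S a a∈X) (Y⊆S b b∈Y) c<a c<b
        (Disjoint⇒≢ disj a∈X b∈Y) (cX c a c∈X a∈X (a≢c ∘ ≡-sym))
        (back-cross-edge⇒adj-beyond disj cY X⊆S Y⊆S c∈X x∈Y x<c cx b b∈Y c≤b)
      where
      c<a : c < a
      c<a = ≤∧≢⇒< c≤a (a≢c ∘ ≡-sym)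
      c<b : c < b
      c<b = ≤∧≢⇒< c≤b (Disjoint⇒≢ disj c∈X b∈Y)

Complete : ∀ {n} → OrderedGraph n → Subset n → Subset n → ℕ → Set
Complete G A B k = ∀ a b → a ∈ A → InJ k a → b ∈ B → InJ k b → Adj G a b

DFree⇒cut : ∀ {n} (G : OrderedGraph n) {A B : Subset n} →
            Disjoint A B → IsClique G A → IsClique G B → InducedDFree G (λ v → v ∈ A ∪ B) →
            ∃[ k ] (k ≤ n × (∀ c → InI k c → ¬ BackCross G A B c) × Complete G A B k)
DFree⇒cut {n} G {A} {B} disj cA cB free with least-or-none (BackCross? G A B)
... | inj₁ none = n , ℕ.≤-refl , (λ c _ → none c) , J-empty
  where
  J-empty : Complete G A B n
  J-empty a _ _ n≤a _ _ = ⊥-elim (ℕ.<⇒≱ (toℕ<n a) n≤a)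
... | inj₂ (c , (x , x<c , cross , cx) , least) = toℕ c , ℕ.<⇒≤ (toℕ<n c) , least , complete cross
  where
  complete : Cross A B c x → Complete G A B (toℕ c)
  complete (inj₁ (c∈A , x∈B)) =
    complete-beyond-back-cross-edge G free disj cA cB (λ _ → inj₁) (λ _ → inj₂) c∈A x∈B x<c cx
  complete (inj₂ (c∈B , x∈A)) a b a∈A a∈J b∈B b∈J = Adj-sym G
    (complete-beyond-back-cross-edge G free (Disjoint-sym disj) cB cA (λ _ → inj₂) (λ _ → inj₁)
       c∈B x∈A x<c cx b a b∈B b∈J a∈A a∈J)

DFree⇒Conditions : ∀ {n} (G : OrderedGraph n) {A B : Subset n} →
                   Disjoint A B → IsClique G A → IsClique G B →
                   InducedDFree G (λ v → v ∈ A ∪ B) → ∃[ k ] (k ≤ n × Conditions G A B k)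
DFree⇒Conditions G disj cA cB free with DFree⇒cut G disj cA cB free
... | k , k≤n , none-below , complete = k , k≤n
    , no-BackCross⇒no-cross-edge G disj none-below
    , complete
    , (λ b b∈B b∈J → clique-nbhd-suffix G free cA (λ _ → inj₁) (inj₂ b∈B) b∈J)
    , (λ a a∈A a∈J → clique-nbhd-suffix G free cB (λ _ → inj₂) (inj₁ a∈A) a∈J)

lemma2p5 : ∀ {n} (G : OrderedGraph n) (A B : Subset n) →
    Disjoint A B → IsClique G A → IsClique G B →
    InducedDFree G (λ v → v ∈ A ∪ B) ⇔ (∃[ k ] (k ≤ n × Conditions G A B k))
lemma2p5 G A B disj cA cB = mk⇔
  (DFree⇒Conditions G disj cA cB)
  (λ (_ , _ , conds) → Conditions⇒DFree G cA cB conds)
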